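{- Let $\mathbf{K}$ be a local class, $i\in\mathbb{N}\cup\{\infty\}$, $A\in\mathbf{K}^{\subset i}$, $0\le k\le\|A\|$, and $X$ a finite subset of $\{j\in\mathbb{N}: j<i\}$ with $|A|\subseteq X$. Then \[\mu_i(O_i(A,k))=\sum_{S\in\mathbf{K}^{X,k}_{A,k}}\mu_i(O_i(S,k)).\]
   Context: A relational signature $\Sigma$ is locally finite if it has finitely many $n$-ary relation symbols for each $n$. General Irreflexivity axioms: for every $R\in\Sigma$ of arity $n\ge2$ and distinct $i,j$, $\forall\bar x\,(R(x_1,\dots,x_n)\to x_i\ne x_j)$. A local sentence has the form $\forall x_1\cdots\forall x_m(R(x_1,\dots,x_m)\to\psi)$, $m>0$, $R\in\Sigma$ of arity $m$, $\psi$ quantifier-free. A local class is the class $\mathbf{K}=\mathrm{Mod}\,\Phi$ of all finite $\Sigma$-structures (with $\Sigma$ locally finite relational) with underlying set a subset of $\mathbb{N}$ satisfying a set $\Phi$ of local sentences containing all General Irreflexivity axioms. $|M|$ is the underlying set, $\|\cdot\|$ cardinality, $S\restriction Y$ the induced substructure on $Y$. The $k$-frame $A^{(k)}$ keeps the underlying set and relations of arity $\le k$ and empties higher-arity relations. For $N\in\mathbb{N}$: $\mathbf{K}^N$ = members of $\mathbf{K}$ with underlying set $\{0,\dots,N-1\}$, $\mathbf{K}^{\subset N}$ = members with underlying set a subset of $\{0,\dots,N-1\}$; $\mathbf{K}^{\subset\infty}=\mathbf{K}$; $\mathbf{K}^\infty$ = $\Sigma$-structures on $\mathbb{N}$ satisfying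 $\Phi$. For $A\in\mathbf{K}^{\subset i}$ and $k\in\mathbb{N}$: $O_i(A,k)=\{S\in\mathbf{K}^i:(S\restriction|A|)^{(k)}=A^{(k)}\}$. $N(S,k)$ is the number of distinct $(k+1)$-frames of $T\in\mathbf{K}$ with $|T|=|S|$ and $T^{(k)}=S^{(k)}$. $\mu_i$ is defined on these sets recursively by $\mu_i(O_i(A,0))=1$ and $\mu_i(O_i(A,k+1))=\mu_i(O_i(A,k))/N(A,k)$ (for a $k$-frame $S$, $O_i(S,k)$ and $\mu_i(O_i(S,k))$ are understood with $S$ viewed as a structure on its underlying set, which lies in $\mathbf{K}$). For finite $X\subseteq\mathbb{N}$, a structure $A$ with $|A|\subseteq X$ and $k\le l$ with $k\le\|A\|$, $l\le\|X\|$: $\mathbf{K}^{X,l}_{A,k}=\{B^{(l)}:B\in\mathbf{K},\ |B|=X,\ (B^{(k)})\restriction|A|=A^{(k)}\}$. -}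

module Defs where

open import Data.Nat using (ℕ; zero; suc; _<_; _≤_; _≤ᵇ_)
open import Data.Bool using (Bool; true; false; _∧_; _∨_; not; if_then_else_)
open import Data.Fin using (Fin)
open import Data.Fin.Properties using () renaming (_≟_ to _≟F_)
open import Data.Vec using (Vec; lookup; map)
open import Data.Vec.Relation.Unary.All using (All)
open import Data.List using (List; []; _∷_; length; foldr)
open import Data.List.Relation.Unary.All using () renaming (All to AllL)
open import Data.List.Relation.Unary.Any using () renaming (Any to AnyL)
open import Data.List.Relation.Unary.AllPairs using (AllPairs)
open import Data.Integer using (+_)
open import Data.Rational using (ℚ; 0ℚ; 1ℚ; _/_) renaming (_*_ to _*ℚ_; _+_ to _+ℚ_)
open import Data.Product using (Σ; _×_; ∃)
open import Data.Maybe using (Maybe; just; nothing)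
open import Relation.Nullary using (¬_; does)
open import Relation.Binary.PropositionalEquality using (_≡_; _≢_)

-- Locally finite relational signature: finitely many (nsym n) symbols
-- of each arity n.

record Sig : Set where
  field nsym : ℕ → ℕ
open Sig public

record FinSub : Set where
  field
    mem     : ℕ → Bool
    bnd     : ℕ
    bounded : ∀ j → mem j ≡ true → j < bnd
open FinSub public

countBelow : (ℕ → Bool) → ℕ → ℕ
countBelow p zero = zero
countBelow p (suc b) = (if p b then suc else (λ n → n)) (countBelow p b)

card : FinSub → ℕ
card X = countBelow (mem X) (bnd X)

_≐_ : FinSub → FinSub → Set
X ≐ Y = ∀ j → mem X j ≡ mem Y j

_⊆_ : FinSub → FinSub → Set
X ⊆ Y = ∀ j → mem X j ≡ true → mem Y j ≡ true

sumℚ : List ℚ → ℚ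
sumℚ = foldr _+ℚ_ 0ℚ

-- ℕ ∪ {∞}: nothing = ∞
ℕ∞ : Set
ℕ∞ = Maybe ℕ

_⊆below_ : FinSub → ℕ∞ → Set
X ⊆below nothing = Data.Unit.⊤ where import Data.Unit
X ⊆below just i  = ∀ j → mem X j ≡ true → j < i

module _ (σ : Sig) where

  record Str : Set where
    field
      univ  : FinSub
      rel   : (n : ℕ) → Fin (nsym σ n) → Vec ℕ n → Bool
      relIn : ∀ n s xs → rel n s xs ≡ true → All (λ x → mem univ x ≡ true) xs
  open Str public

  _≅_ : Str → Str → Set
  A ≅ B = (univ A ≐ univ B) × (∀ n s xs → rel A n s xs ≡ rel B n s xs)

  frame : ℕ → Str → Str
  frame k A = record
    { univ  = univ A
    ; rel   = λ n s xs → (n ≤ᵇ k) ∧ rel A n s xs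
    ; relIn = λ n s xs e → relIn A n s xs (lemma (n ≤ᵇ k) e) }
    where
      lemma : ∀ b {c} → b ∧ c ≡ true → c ≡ true
      lemma true e = e

  allMem : (ℕ → Bool) → ∀ {n} → Vec ℕ n → Bool
  allMem p Vec.[] = true where import Data.Vec as Vec
  allMem p (x Vec.∷ xs) = p x ∧ allMem p xs where import Data.Vec as Vec

  restrict : Str → FinSub → Str
  restrict S Y = record
    { univ  = record { mem = λ j → mem (univ S) j ∧ mem Y j
                     ; bnd = bnd (univ S)
                     ; bounded = λ j e → bounded (univ S) j (∧-l (mem (univ S) j) e) }
    ; rel   = λ n s xs → rel S n s xs ∧ allMem (mem Y) xs
    ; relIn = λ n s xs e → go xs (relIn S n s xs (∧-l (rel S n s xs) e)) (∧-r (rel S n s xs) e) }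
    where
      ∧-l : ∀ a {b} → a ∧ b ≡ true → a ≡ true
      ∧-l true _ = Relation.Binary.PropositionalEquality.refl
        where import Relation.Binary.PropositionalEquality
      ∧-r : ∀ a {b} → a ∧ b ≡ true → b ≡ true
      ∧-r true e = e
      go : ∀ {n} (xs : Vec ℕ n) → All (λ x → mem (univ S) x ≡ true) xs → allMem (mem Y) xs ≡ true
         → All (λ x → mem (univ S) x ∧ mem Y x ≡ true) xs
      go Data.Vec.[] All.[] _ = All.[] where import Data.Vec.Relation.Unary.All as All
      go (x Data.Vec.∷ xs) (px All.∷ pxs) e =
        aux px (∧-l (mem Y x) e) All.∷ go xs pxs (∧-r (mem Y x) e)
        where
          import Data.Vec.Relation.Unary.All as All
          aux : ∀ {a b} → a ≡ true → b ≡ true → a ∧ b ≡ true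
          aux Relation.Binary.PropositionalEquality.refl Relation.Binary.PropositionalEquality.refl
            = Relation.Binary.PropositionalEquality.refl
            where import Relation.Binary.PropositionalEquality

  data QF (m : ℕ) : Set where
    ⊤f ⊥f : QF m
    eqf   : Fin m → Fin m → QF m
    relf  : (n : ℕ) → Fin (nsym σ n) → Vec (Fin m) n → QF m
    negf  : QF m → QF m
    andf  : QF m → QF m → QF m
    orf   : QF m → QF m → QF m

  evalQF : ∀ {m} → Str → Vec ℕ m → QF m → Bool
  evalQF A v ⊤f = true
  evalQF A v ⊥f = false
  evalQF A v (eqf a b) = does (lookup v a Data.Nat.≟ lookup v b) where import Data.Nat
  evalQF A v (relf n s ys) = rel A n s (map (lookup v) ys)
  evalQF A v (negf φ) = not (evalQF A v φ)
  evalQF A v (andf φ ψ) = evalQF A v φ ∧ evalQF A v ψ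
  evalQF A v (orf φ ψ) = evalQF A v φ ∨ evalQF A v ψ

  -- Local sentence ∀x₁…∀xₘ (R(x₁,…,xₘ) → ψ), with m = suc ar > 0
  record Local : Set where
    field
      ar   : ℕ
      sym  : Fin (nsym σ (suc ar))
      body : QF (suc ar)
  open Local public

  -- Satisfaction (the quantifiers range over |A|; tuples in R lie in |A|
  -- automatically, so quantifying over all tuples of ℕ is equivalent)
  _⊨_ : Str → Local → Set
  A ⊨ φ = ∀ (xs : Vec ℕ (suc (ar φ))) → rel A (suc (ar φ)) (sym φ) xs ≡ true
          → evalQF A xs (body φ) ≡ true

  GI : (n : ℕ) → Fin (nsym σ (suc (suc n))) → Fin (suc (suc n)) → Fin (suc (suc n)) → Local
  GI n R i j = record { ar = suc n ; sym = R ; body = negf (eqf i j) }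

  ContainsGI : (Local → Set) → Set
  ContainsGI Φ = ∀ n R i j → i ≢ j → Φ (GI n R i j)

  InK : (Local → Set) → Str → Set
  InK Φ A = ∀ φ → Φ φ → A ⊨ φ

  Enumerates : (Str → Set) → List Str → Set
  Enumerates P L = AllL P L × AllPairs (λ a b → ¬ (a ≅ b)) L
                   × (∀ S → P S → AnyL (S ≅_) L)

  NSet : (Local → Set) → Str → ℕ → Str → Set
  NSet Φ S k F = ∃ λ T → InK Φ T × (univ T ≐ univ S)
                 × (frame k T ≅ frame k S) × (frame (suc k) T ≅ F)

  HasN : (Local → Set) → Str → ℕ → ℕ → Set
  HasN Φ S k n = Σ (List Str) λ L → Enumerates (NSet Φ S k) L × length L ≡ n

  ℕtoℚ : ℕ → ℚ
  ℕtoℚ n = + n / 1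

  -- Mu Φ A k q  :  μ_i(O_i(A,k)) = q, by the recursion
  --   μ(O(A,0)) = 1,   μ(O(A,k+1)) = μ(O(A,k)) / N(A,k)
  -- (written multiplicatively: q' · N(A,k) = q)
  data Mu (Φ : Local → Set) (A : Str) : ℕ → ℚ → Set where
    mu0 : Mu Φ A 0 1ℚ
    muS : ∀ {k q q' n} → Mu Φ A k q → HasN Φ A k n → q' *ℚ ℕtoℚ n ≡ q
        → Mu Φ A (suc k) q'

  KXA : (Local → Set) → FinSub → ℕ → Str → ℕ → Str → Set
  KXA Φ X l A k S = ∃ λ B → InK Φ B × (univ B ≐ X)
                    × (restrict (frame k B) (univ A) ≅ frame k A) × (frame l B ≅ S)

-- For k = 0 both sides equal 1, since K^{X,0}_{A,0} has a single member.
-- For the step, group the members S of K^{X,k+1}_{A,k+1} by their k-frames, which run through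
-- K^{X,k}_{A,k}. A (k+1)-frame F over S^(k) is the same thing as a (k+1)-frame F ↾ |A| over A^(k)
-- together with a member of the class of S (F with A's (k+1)-ary relations put back on |A|); general
-- irreflexivity keeps such overlays inside K, because a tuple meeting both parts repeats an entry.
-- Hence N(S,k) = N(A,k) · #class, and as μ(O(S,k+1)) = μ(O(S^(k),k)) / N(S,k) is constant on the
-- class, the class contributes μ(O(S^(k),k)) / N(A,k). Summing over the classes with the induction
-- hypothesis gives μ(O(A,k)) / N(A,k) = μ(O(A,k+1)).

module Submission where

open import Defs renaming (sym to relSymbol)
open import Data.Bool using (Bool; true; false; _∧_; _∨_; not; if_then_else_)
open import Data.Bool.Properties
  using (∧-conicalˡ; ∧-conicalʳ; ∧-identityʳ; ∧-zeroʳ; ∧-assoc; ¬-not; T-≡) renaming (_≟_ to _≟ᴮ_)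
open import Data.Nat using (ℕ; zero; suc; _≤_; _<_; _+_; _*_; _≤ᵇ_; _≡ᵇ_; z≤n; s≤s; s≤s⁻¹)
open import Data.Nat.Properties
  using (≤⇒≤ᵇ; ≤ᵇ⇒≤; ≡ᵇ⇒≡; ≡⇒≡ᵇ; ≤-refl; ≤-trans; ≤-antisym; <⇒≤; <⇒≢; <⇒≱; ≤-<-trans; ≰⇒>; <-cmp;
         n≤1+n; m≤n⇒m≤1+n; allUpTo?)
open import Data.Fin using (Fin) renaming (zero to fzero; suc to fsuc)
import Data.Fin as Fin
open import Data.Fin.Properties using (pigeonhole; punchOut-injective; any?; all?; injective⇒≤) renaming (_≟_ to _≟ᶠ_)
open import Data.Vec using (Vec; []; _∷_; lookup) renaming (map to vmap)
open import Data.Vec.Properties using (lookup-map)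
open import Data.Vec.Relation.Unary.All using ([]; _∷_) renaming (All to AllV)
import Data.Vec.Relation.Unary.All as AllV
open import Data.Vec.Relation.Unary.All.Properties using (lookup⁺; lookup⁻)
open import Data.Product using (Σ; _×_; _,_; proj₁; proj₂; ∃)
open import Data.Empty using (⊥; ⊥-elim)
open import Data.Sum using (inj₁; inj₂)
open import Function using (_∘_; Equivalence)
open import Relation.Nullary using (¬_; Dec; yes; no; does; map′)
open import Relation.Binary.Definitions using (tri<; tri≈; tri>)
open import Relation.Binary.Bundles using (Setoid; DecSetoid)
open import Algebra.Bundles using (CommutativeMonoid)
open import Level using (0ℓ)
open import Data.List using (List; []; _∷_; length; cartesianProduct; _++_; filter; deduplicate)
import Data.List as List
open import Data.List.Properties using (length-++; length-map)
import Data.List.Relation.Unary.All as AllL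
open import Data.List.Relation.Unary.All using ([]; _∷_)
open import Data.List.Relation.Unary.All.Properties using (All¬⇒¬Any)
import Data.List.Relation.Unary.All.Properties as AllLP
import Data.List.Relation.Unary.Any.Properties as AnyP
import Data.List.Relation.Unary.Unique.Setoid.Properties as UniqueP
open import Data.Product.Relation.Binary.Pointwise.NonDependent using (_×ₛ_)
open import Data.List.Relation.Unary.Any using (here; there)
open import Data.List.Relation.Unary.AllPairs using ([]; _∷_)
import Data.List.Relation.Unary.AllPairs.Properties as AllPairsP
open import Data.List.Relation.Binary.Pointwise using (Pointwise; []; _∷_)
import Data.List.Relation.Unary.AllPairs as AllPairs
import Data.List.Relation.Unary.Any as Any
open import Data.List.Membership.Setoid.Properties
  using (∈-lookup; index-injective; ∈-resp-≈; ∈-map⁺; ∈-deduplicate⁺; ∈-length)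
open import Data.List.Relation.Unary.Unique.DecSetoid.Properties using (deduplicate-!)
open import Relation.Binary.Properties.Setoid using (respʳ-flip)
open import Data.List.Membership.Propositional.Properties using () renaming (∈-lookup to ∈ₚ-lookup)
open import Data.Rational using (ℚ; 0ℚ; 1ℚ; toℚᵘ)
import Data.Rational as ℚ
import Data.Rational.Properties as ℚP
open import Data.Rational.Properties using (toℚᵘ-injective; toℚᵘ-homo-+; toℚᵘ-homo-*; normalize-coprime)
import Data.Rational.Unnormalised as ℚᵘ
import Data.Rational.Unnormalised.Properties as ℚᵘP
import Data.Integer as ℤ
import Data.Integer.Properties as ℤP
open import Data.Nat.Coprimality using (1-coprimeTo)
import Data.Nat.Coprimality as Coprime
open import Relation.Binary.PropositionalEquality
  using (_≡_; _≢_; refl; sym; trans; cong; cong₂; subst; module ≡-Reasoning) renaming (setoid to ≡-setoid)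

∧-intro : ∀ {a b} → a ≡ true → b ≡ true → a ∧ b ≡ true
∧-intro refl refl = refl

true≢false : ∀ {b} → b ≡ true → b ≡ false → ⊥
true≢false refl ()

≤ᵇ-true : ∀ {n k} → n ≤ k → (n ≤ᵇ k) ≡ true
≤ᵇ-true p = Equivalence.to T-≡ (≤⇒≤ᵇ p)

≤ᵇ-true⁻ : ∀ {n k} → (n ≤ᵇ k) ≡ true → n ≤ k
≤ᵇ-true⁻ {n} {k} e = ≤ᵇ⇒≤ n k (Equivalence.from T-≡ e)

≤ᵇ-false : ∀ {n k} → k < n → (n ≤ᵇ k) ≡ false
≤ᵇ-false k<n = ¬-not λ e → <⇒≱ k<n (≤ᵇ-true⁻ e)

≡ᵇ-true : ∀ {m n} → m ≡ n → (m ≡ᵇ n) ≡ true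
≡ᵇ-true {m} {n} e = Equivalence.to T-≡ (≡⇒≡ᵇ m n e)

≡ᵇ-true⁻ : ∀ {m n} → (m ≡ᵇ n) ≡ true → m ≡ n
≡ᵇ-true⁻ {m} {n} e = ≡ᵇ⇒≡ m n (Equivalence.from T-≡ e)

≡ᵇ-false : ∀ {m n} → m ≢ n → (m ≡ᵇ n) ≡ false
≡ᵇ-false m≢n = ¬-not λ e → m≢n (≡ᵇ-true⁻ e)

-- Counting up to an equivalence

module _ {c ℓ} (S : Setoid c ℓ) where

  open Setoid S using (Carrier; _≈_) renaming (sym to ≈-sym)
  open import Data.List.Membership.Setoid S using (_∈_)
  open import Data.List.Relation.Binary.Subset.Setoid S using () renaming (_⊆_ to _⊆ₗ_)
  open import Data.List.Relation.Unary.Unique.Setoid S using (Unique)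

  lookup-injective : ∀ {xs} → Unique xs → ∀ i j → List.lookup xs i ≈ List.lookup xs j → i ≡ j
  lookup-injective {_ ∷ _} _ fzero fzero _ = refl
  lookup-injective {_ ∷ _} (x∉xs ∷ _) fzero (fsuc j) eq = ⊥-elim (AllL.lookup x∉xs (∈ₚ-lookup j) eq)
  lookup-injective {_ ∷ _} (x∉xs ∷ _) (fsuc i) fzero eq = ⊥-elim (AllL.lookup x∉xs (∈ₚ-lookup i) (≈-sym eq))
  lookup-injective {_ ∷ _} (_ ∷ xs!) (fsuc i) (fsuc j) eq = cong fsuc (lookup-injective xs! i j eq)

  all⇒⊆ : ∀ {p} {P : Carrier → Set p} {xs ys} → AllL.All P xs → (∀ x → P x → x ∈ ys) → xs ⊆ₗ ys
  all⇒⊆ (Px ∷ _) h (here y≈x) = ∈-resp-≈ S (≈-sym y≈x) (h _ Px)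
  all⇒⊆ (_ ∷ Pxs) h (there y∈xs) = all⇒⊆ Pxs h y∈xs

  unique-⊆⇒length≤ : ∀ {xs ys} → Unique xs → xs ⊆ₗ ys → length xs ≤ length ys
  unique-⊆⇒length≤ {xs} xs! xs⊆ys = injective⇒≤ λ {i} {j} eq →
    lookup-injective xs! i j (index-injective S (xs⊆ys (∈-lookup S xs i)) (xs⊆ys (∈-lookup S xs j)) eq)

  unique-⊆-⊇⇒length≡ : ∀ {xs ys} → Unique xs → Unique ys → xs ⊆ₗ ys → ys ⊆ₗ xs → length xs ≡ length ys
  unique-⊆-⊇⇒length≡ xs! ys! xs⊆ys ys⊆xs =
    ≤-antisym (unique-⊆⇒length≤ xs! xs⊆ys) (unique-⊆⇒length≤ ys! ys⊆xs)

length-cartesianProduct : ∀ {A B : Set} (xs : List A) (ys : List B) →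
                          length (cartesianProduct xs ys) ≡ length xs * length ys
length-cartesianProduct [] ys = refl
length-cartesianProduct (x ∷ xs) ys = begin
  length (List.map (x ,_) ys ++ cartesianProduct xs ys)          ≡⟨ length-++ (List.map (x ,_) ys) ⟩
  length (List.map (x ,_) ys) + length (cartesianProduct xs ys)  ≡⟨ cong₂ _+_ (length-map (x ,_) ys)
                                                                             (length-cartesianProduct xs ys) ⟩
  length ys + length xs * length ys                              ∎
  where open ≡-Reasoning

any-filter⁺ : ∀ {A : Set} {P Q : A → Set} (Q? : ∀ x → Dec (Q x)) {xs} →
              (∀ {x} → P x → Q x) → Any.Any P xs → Any.Any P (filter Q? xs)
any-filter⁺ Q? P⇒Q p with AnyP.filter⁺ Q? p
... | inj₁ p′ = p′
... | inj₂ ¬Q = ⊥-elim (¬Q (P⇒Q (AnyP.lookup-result p)))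

-- Finite sums of rationals

fromℕ : ℕ → ℚ
fromℕ n = ℤ.+ n ℚ./ 1

toℚᵘ-fromℕ : ∀ n → toℚᵘ (fromℕ n) ≡ ℚᵘ.mkℚᵘ (ℤ.+ n) 0
toℚᵘ-fromℕ n = cong toℚᵘ (normalize-coprime (Coprime.sym (1-coprimeTo n)))

fromℕ-homo-+ : ∀ a b → fromℕ (a + b) ≡ fromℕ a ℚ.+ fromℕ b
fromℕ-homo-+ a b = toℚᵘ-injective (begin
  toℚᵘ (fromℕ (a + b))                                ≡⟨ toℚᵘ-fromℕ (a + b) ⟩
  ℚᵘ.mkℚᵘ (ℤ.+ (a + b)) 0                            ≈⟨ ℚᵘ.*≡* (cong (ℤ._* ℤ.+ 1) (trans (ℤP.pos-+ a b)
                                                          (cong₂ ℤ._+_ (sym (ℤP.*-identityʳ (ℤ.+ a)))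
                                                                       (sym (ℤP.*-identityʳ (ℤ.+ b)))))) ⟩
  ℚᵘ.mkℚᵘ (ℤ.+ a) 0 ℚᵘ.+ ℚᵘ.mkℚᵘ (ℤ.+ b) 0          ≡⟨ sym (cong₂ ℚᵘ._+_ (toℚᵘ-fromℕ a) (toℚᵘ-fromℕ b)) ⟩
  toℚᵘ (fromℕ a) ℚᵘ.+ toℚᵘ (fromℕ b)                  ≈⟨ ℚᵘP.≃-sym (toℚᵘ-homo-+ (fromℕ a) (fromℕ b)) ⟩
  toℚᵘ (fromℕ a ℚ.+ fromℕ b)                          ∎)
  where open ℚᵘP.≃-Reasoning

fromℕ-homo-* : ∀ a b → fromℕ (a * b) ≡ fromℕ a ℚ.* fromℕ b
fromℕ-homo-* a b = toℚᵘ-injective (begin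
  toℚᵘ (fromℕ (a * b))                                ≡⟨ toℚᵘ-fromℕ (a * b) ⟩
  ℚᵘ.mkℚᵘ (ℤ.+ (a * b)) 0                            ≈⟨ ℚᵘ.*≡* (cong (ℤ._* ℤ.+ 1) (ℤP.pos-* a b)) ⟩
  ℚᵘ.mkℚᵘ (ℤ.+ a) 0 ℚᵘ.* ℚᵘ.mkℚᵘ (ℤ.+ b) 0          ≡⟨ sym (cong₂ ℚᵘ._*_ (toℚᵘ-fromℕ a) (toℚᵘ-fromℕ b)) ⟩
  toℚᵘ (fromℕ a) ℚᵘ.* toℚᵘ (fromℕ b)                  ≈⟨ ℚᵘP.≃-sym (toℚᵘ-homo-* (fromℕ a) (fromℕ b)) ⟩
  toℚᵘ (fromℕ a ℚ.* fromℕ b)                          ∎)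
  where open ℚᵘP.≃-Reasoning

*-cancelʳ-fromℕ-suc : ∀ m {p q} → p ℚ.* fromℕ (suc m) ≡ q ℚ.* fromℕ (suc m) → p ≡ q
*-cancelʳ-fromℕ-suc m {p} {q} eq = begin
  p                    ≡⟨ sym (ℚP.*-identityʳ p) ⟩
  p ℚ.* 1ℚ             ≡⟨ cong (p ℚ.*_) (sym (ℚP.*-inverseʳ c)) ⟩
  p ℚ.* (c ℚ.* ℚ.1/ c)   ≡⟨ sym (ℚP.*-assoc p c (ℚ.1/ c)) ⟩
  (p ℚ.* c) ℚ.* ℚ.1/ c   ≡⟨ cong (ℚ._* ℚ.1/ c) eq ⟩
  (q ℚ.* c) ℚ.* ℚ.1/ c   ≡⟨ ℚP.*-assoc q c (ℚ.1/ c) ⟩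
  q ℚ.* (c ℚ.* ℚ.1/ c)   ≡⟨ cong (q ℚ.*_) (ℚP.*-inverseʳ c) ⟩
  q ℚ.* 1ℚ             ≡⟨ ℚP.*-identityʳ q ⟩
  q                    ∎
  where
    open ≡-Reasoning
    c = fromℕ (suc m)
    instance
      c≢0 : ℚ.NonZero c
      c≢0 = subst ℚ.NonZero (sym (normalize-coprime (Coprime.sym (1-coprimeTo (suc m))))) _

module _ {I : Set} where

  ∑ : (I → ℚ) → List I → ℚ
  ∑ f xs = sumℚ (List.map f xs)

  ∑-cong : ∀ {f g : I → ℚ} {xs} → AllL.All (λ x → f x ≡ g x) xs → ∑ f xs ≡ ∑ g xs
  ∑-cong [] = refl
  ∑-cong (eq ∷ eqs) = cong₂ ℚ._+_ eq (∑-cong eqs)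

  ∑-const : ∀ c (xs : List I) → ∑ (λ _ → c) xs ≡ fromℕ (length xs) ℚ.* c
  ∑-const c [] = sym (ℚP.*-zeroˡ c)
  ∑-const c (x ∷ xs) = begin
    c ℚ.+ ∑ (λ _ → c) xs                          ≡⟨ cong₂ ℚ._+_ (sym (ℚP.*-identityˡ c)) (∑-const c xs) ⟩
    1ℚ ℚ.* c ℚ.+ fromℕ (length xs) ℚ.* c           ≡⟨ sym (ℚP.*-distribʳ-+ c 1ℚ (fromℕ (length xs))) ⟩
    (1ℚ ℚ.+ fromℕ (length xs)) ℚ.* c               ≡⟨ cong (ℚ._* c) (sym (fromℕ-homo-+ 1 (length xs))) ⟩
    fromℕ (suc (length xs)) ℚ.* c                  ∎
    where open ≡-Reasoning

  ∑-*ˡ : ∀ c (f : I → ℚ) xs → c ℚ.* ∑ f xs ≡ ∑ (λ x → c ℚ.* f x) xs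
  ∑-*ˡ c f [] = ℚP.*-zeroʳ c
  ∑-*ˡ c f (x ∷ xs) = trans (ℚP.*-distribˡ-+ c (f x) (∑ f xs)) (cong (c ℚ.* f x ℚ.+_) (∑-*ˡ c f xs))

  ∑-+ : ∀ (f g : I → ℚ) xs → ∑ (λ x → f x ℚ.+ g x) xs ≡ ∑ f xs ℚ.+ ∑ g xs
  ∑-+ f g [] = refl
  ∑-+ f g (x ∷ xs) = trans (cong (f x ℚ.+ g x ℚ.+_) (∑-+ f g xs)) (interchange (f x) (g x) (∑ f xs) (∑ g xs))
    where open import Algebra.Properties.CommutativeSemigroup
            (CommutativeMonoid.commutativeSemigroup ℚP.+-0-commutativeMonoid) using (interchange)

module _ {ℓ} (DS : DecSetoid 0ℓ ℓ) where

  open DecSetoid DS using (_≈_; _≟_; setoid) renaming (Carrier to I; sym to ≈-sym; trans to ≈-trans)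
  open import Data.List.Membership.Setoid setoid using (_∈_)
  open import Data.List.Relation.Unary.Unique.Setoid setoid using (Unique)

  classOf : I → List I → List I
  classOf d = filter (_≟ d)

  private
    indicator : I → ℚ → I → ℚ
    indicator x q d = if does (x ≟ d) then q else 0ℚ

    ∑-indicator-∉ : ∀ {x} q {ds} → AllL.All (λ d → ¬ x ≈ d) ds → ∑ (indicator x q) ds ≡ 0ℚ
    ∑-indicator-∉ q [] = refl
    ∑-indicator-∉ {x} q {d ∷ _} (x≉d ∷ x≉ds) with x ≟ d
    ... | yes x≈d = ⊥-elim (x≉d x≈d)
    ... | no _ = trans (ℚP.+-identityˡ _) (∑-indicator-∉ q x≉ds)

    ∑-indicator : ∀ {x} q {ds} → Unique ds → x ∈ ds → ∑ (indicator x q) ds ≡ q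
    ∑-indicator {x} q {d ∷ _} (d∉ds ∷ _) (here x≈d) with x ≟ d
    ... | yes _ = trans (cong (q ℚ.+_) (∑-indicator-∉ q x≉ds)) (ℚP.+-identityʳ q)
      where x≉ds = AllL.map (λ d≉d′ x≈d′ → d≉d′ (≈-trans (≈-sym x≈d) x≈d′)) d∉ds
    ... | no x≉d = ⊥-elim (x≉d x≈d)
    ∑-indicator {x} q {d ∷ _} (d∉ds ∷ ds!) (there x∈ds) with x ≟ d
    ... | yes x≈d = ⊥-elim (All¬⇒¬Any d∉ds (∈-resp-≈ setoid x≈d x∈ds))
    ... | no _ = trans (ℚP.+-identityˡ _) (∑-indicator q ds! x∈ds)

    ∑-classOf-∷ : ∀ (f : I → ℚ) x xs d → ∑ f (classOf d (x ∷ xs)) ≡ indicator x (f x) d ℚ.+ ∑ f (classOf d xs)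
    ∑-classOf-∷ f x xs d with x ≟ d
    ... | yes _ = refl
    ... | no _ = sym (ℚP.+-identityˡ _)

  ∑-by-classes : ∀ (f : I → ℚ) xs {ds} → Unique ds → AllL.All (_∈ ds) xs →
                 ∑ f xs ≡ ∑ (λ d → ∑ f (classOf d xs)) ds
  ∑-by-classes f [] {ds} _ [] = sym (trans (∑-const 0ℚ ds) (ℚP.*-zeroʳ (fromℕ (length ds))))
  ∑-by-classes f (x ∷ xs) {ds} ds! (x∈ds ∷ xs∈ds) = begin
    f x ℚ.+ ∑ f xs
      ≡⟨ cong₂ ℚ._+_ (sym (∑-indicator (f x) ds! x∈ds)) (∑-by-classes f xs ds! xs∈ds) ⟩
    ∑ (indicator x (f x)) ds ℚ.+ ∑ (λ d → ∑ f (classOf d xs)) ds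
      ≡⟨ sym (∑-+ _ _ ds) ⟩
    ∑ (λ d → indicator x (f x) d ℚ.+ ∑ f (classOf d xs)) ds
      ≡⟨ ∑-cong {xs = ds} (AllL.tabulate λ {d} _ → sym (∑-classOf-∷ f x xs d)) ⟩
    ∑ (λ d → ∑ f (classOf d (x ∷ xs))) ds ∎
    where open ≡-Reasoning

  ∑-by-representatives : ∀ (f : I → ℚ) xs → ∑ f xs ≡ ∑ (λ d → ∑ f (classOf d xs)) (deduplicate _≟_ xs)
  ∑-by-representatives f xs = ∑-by-classes f xs (deduplicate-! DS xs) (AllL.tabulate λ x∈xs →
    ∈-deduplicate⁺ setoid _≟_ (respʳ-flip setoid) (Any.map (λ { refl → Setoid.refl setoid }) x∈xs))

-- Structures, frames and overlays

module _ (σ : Sig) where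

  private
    variable
      m n k l : ℕ
      p p′ : ℕ → Bool

  allMem-lookup : (xs : Vec ℕ n) → allMem σ p xs ≡ true → ∀ i → p (lookup xs i) ≡ true
  allMem-lookup {p = p} (x ∷ xs) e fzero = ∧-conicalˡ (p x) _ e
  allMem-lookup {p = p} (x ∷ xs) e (fsuc i) = allMem-lookup xs (∧-conicalʳ (p x) _ e) i

  allMem-tabulate : (xs : Vec ℕ n) → (∀ i → p (lookup xs i) ≡ true) → allMem σ p xs ≡ true
  allMem-tabulate [] h = refl
  allMem-tabulate (x ∷ xs) h = ∧-intro (h fzero) (allMem-tabulate xs (h ∘ fsuc))

  allMem-false : (xs : Vec ℕ n) → allMem σ p xs ≡ false → ∃ λ i → p (lookup xs i) ≡ false
  allMem-false {p = p} (x ∷ xs) e with p x in px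
  ... | false = fzero , px
  ... | true with allMem-false xs e
  ...   | i , pi = fsuc i , pi

  allMem-map-lookup : (xs : Vec ℕ m) (ys : Vec (Fin m) n) →
                      allMem σ p xs ≡ true → allMem σ p (vmap (lookup xs) ys) ≡ true
  allMem-map-lookup {p = p} xs ys e = allMem-tabulate (vmap (lookup xs) ys) λ i →
    subst (λ z → p z ≡ true) (sym (lookup-map i (lookup xs) ys)) (allMem-lookup xs e (lookup ys i))

  allMem-cong : (∀ j → p j ≡ p′ j) → (xs : Vec ℕ n) → allMem σ p xs ≡ allMem σ p′ xs
  allMem-cong h [] = refl
  allMem-cong h (x ∷ xs) = cong₂ _∧_ (h x) (allMem-cong h xs)

  -- Defs' _≅_ as a record: unlike the bare product, it lets Agda infer the two structures.
  infix 4 _≈_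
  record _≈_ (A B : Str σ) : Set where
    constructor mk≈
    field
      univ≐ : univ A ≐ univ B
      rel≡  : ∀ n s xs → rel A n s xs ≡ rel B n s xs
  open _≈_ public

  private
    variable
      A B C D E E′ G G′ S S′ : Str σ
      Y : FinSub

  ≈-refl : A ≈ A
  ≈-refl = mk≈ (λ _ → refl) (λ _ _ _ → refl)

  ≈-sym : A ≈ B → B ≈ A
  ≈-sym (mk≈ u r) = mk≈ (λ j → sym (u j)) (λ n s xs → sym (r n s xs))

  ≈-trans : A ≈ B → B ≈ C → A ≈ C
  ≈-trans (mk≈ u r) (mk≈ u′ r′) = mk≈ (λ j → trans (u j) (u′ j)) (λ n s xs → trans (r n s xs) (r′ n s xs))

  ≈⇒≅ : A ≈ B → _≅_ σ A B
  ≈⇒≅ (mk≈ u r) = u , r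

  ≅⇒≈ : _≅_ σ A B → A ≈ B
  ≅⇒≈ (u , r) = mk≈ u r

  ≈-setoid : Setoid 0ℓ 0ℓ
  ≈-setoid = record
    { Carrier = Str σ ; _≈_ = _≈_
    ; isEquivalence = record { refl = ≈-refl ; sym = ≈-sym ; trans = ≈-trans } }

  infixl 9 _⁽_⁾
  _⁽_⁾ : Str σ → ℕ → Str σ
  A ⁽ k ⁾ = frame σ k A

  infixl 8 _↾_
  _↾_ : Str σ → FinSub → Str σ
  A ↾ Y = restrict σ A Y

  frame-cong : ∀ k → A ≈ B → A ⁽ k ⁾ ≈ B ⁽ k ⁾
  frame-cong k (mk≈ u r) = mk≈ u λ n s xs → cong ((n ≤ᵇ k) ∧_) (r n s xs)

  frame-frame : k ≤ l → (A : Str σ) → A ⁽ l ⁾ ⁽ k ⁾ ≈ A ⁽ k ⁾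
  frame-frame {k} {l} k≤l A = mk≈ (λ _ → refl) λ n s xs → lower n (rel A n s xs)
    where
      lower : ∀ n b → (n ≤ᵇ k) ∧ ((n ≤ᵇ l) ∧ b) ≡ (n ≤ᵇ k) ∧ b
      lower n b with n ≤ᵇ k in n≤k
      ... | false = refl
      ... | true = cong (_∧ b) (≤ᵇ-true {n} {l} (≤-trans (≤ᵇ-true⁻ n≤k) k≤l))

  frame-frame-suc : (A : Str σ) → A ⁽ suc k ⁾ ⁽ k ⁾ ≈ A ⁽ k ⁾
  frame-frame-suc {k} = frame-frame (n≤1+n k)

  frame-below : ∀ {i} → A ⁽ k ⁾ ≈ B ⁽ k ⁾ → i ≤ k → A ⁽ i ⁾ ≈ B ⁽ i ⁾
  frame-below {A = A} {B = B} {i} A≈B i≤k =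
    ≈-trans (≈-sym (frame-frame i≤k A)) (≈-trans (frame-cong i A≈B) (frame-frame i≤k B))

  restrict-cong : ∀ Y → A ≈ B → A ↾ Y ≈ B ↾ Y
  restrict-cong Y (mk≈ u r) =
    mk≈ (λ j → cong (_∧ mem Y j) (u j)) λ n s xs → cong (_∧ allMem σ (mem Y) xs) (r n s xs)

  frame-restrict : ∀ k (A : Str σ) Y → (A ↾ Y) ⁽ k ⁾ ≈ A ⁽ k ⁾ ↾ Y
  frame-restrict k A Y = mk≈ (λ _ → refl) λ n s xs → sym (∧-assoc (n ≤ᵇ k) (rel A n s xs) _)

  rel-outside : (E : Str σ) (s : Fin (nsym σ n)) (xs : Vec ℕ n) (i : Fin n) →
                mem (univ E) (lookup xs i) ≡ false → rel E n s xs ≡ false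
  rel-outside E s xs i out = ¬-not λ e → true≢false (lookup⁺ (relIn E _ s xs e) i) out

  EmptyAbove : ℕ → Str σ → Set
  EmptyAbove l E = ∀ n s xs → l < n → rel E n s xs ≡ false

  frame-emptyAbove : ∀ l (A : Str σ) → EmptyAbove l (A ⁽ l ⁾)
  frame-emptyAbove l A n s xs l<n = cong (_∧ rel A n s xs) (≤ᵇ-false {n} {l} l<n)

  emptyAbove-resp : A ≈ B → EmptyAbove l A → EmptyAbove l B
  emptyAbove-resp (mk≈ _ r) empty n s xs l<n = trans (sym (r n s xs)) (empty n s xs l<n)

  emptyAbove⇒frame≈ : EmptyAbove l E → E ⁽ l ⁾ ≈ E
  emptyAbove⇒frame≈ {l} {E} empty = mk≈ (λ _ → refl) λ n s xs → keep n s xs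
    where
      keep : ∀ n s xs → (n ≤ᵇ l) ∧ rel E n s xs ≡ rel E n s xs
      keep n s xs with n ≤ᵇ l in n≤l
      ... | true = refl
      ... | false = sym (empty n s xs (≰⇒> λ p → true≢false (≤ᵇ-true p) n≤l))

  restrict-emptyAbove : ∀ Y → EmptyAbove l E → EmptyAbove l (E ↾ Y)
  restrict-emptyAbove Y empty n s xs l<n = cong (_∧ allMem σ (mem Y) xs) (empty n s xs l<n)

  inside : Str σ → FinSub → Vec ℕ n → Bool
  inside E Y xs = allMem σ (mem (univ (E ↾ Y))) xs

  overlaid : ℕ → FinSub → Str σ → Vec ℕ n → Bool
  overlaid {n} k Y E xs = (n ≡ᵇ suc k) ∧ inside E Y xs

  overlay : ℕ → FinSub → Str σ → Str σ → Str σ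
  overlay k Y E G = record
    { univ  = univ E
    ; rel   = λ n s xs → if overlaid k Y E xs then rel G n s xs else rel E n s xs
    ; relIn = relIn′ }
    where
      relIn′ : ∀ n s xs → (if overlaid k Y E xs then rel G n s xs else rel E n s xs) ≡ true →
               AllV (λ x → mem (univ E) x ≡ true) xs
      relIn′ n s xs related with overlaid k Y E xs in ov
      ... | false = relIn E n s xs related
      ... | true = lookup⁻ λ i →
        ∧-conicalˡ (mem (univ E) _) _ (allMem-lookup xs (∧-conicalʳ (n ≡ᵇ suc k) _ ov) i)

  AgreeAt : ℕ → FinSub → Str σ → Str σ → Set
  AgreeAt n Y E G = ∀ s xs → inside E Y xs ≡ true → rel E n s xs ≡ rel G n s xs

  AgreeUpTo : ℕ → FinSub → Str σ → Str σ → Set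
  AgreeUpTo k Y E G = ∀ {n} → n ≤ k → AgreeAt n Y E G

  inside⇒allMem : (xs : Vec ℕ n) → inside E Y xs ≡ true → allMem σ (mem Y) xs ≡ true
  inside⇒allMem {E = E} xs e = allMem-tabulate xs λ i →
    ∧-conicalʳ (mem (univ E) (lookup xs i)) _ (allMem-lookup xs e i)

  restrict-frame⇒agreeAt : E ⁽ l ⁾ ↾ Y ≈ G ⁽ l ⁾ → n ≤ l → AgreeAt n Y E G
  restrict-frame⇒agreeAt {E} {l} {Y} {G} {n} (mk≈ _ r) n≤l s xs xs-in = begin
    rel E n s xs                                         ≡⟨ sym (∧-identityʳ _) ⟩
    rel E n s xs ∧ true                                  ≡⟨ cong₂ _∧_ (cong (_∧ rel E n s xs) (sym (≤ᵇ-true {n} {l} n≤l)))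
                                                                       (sym (inside⇒allMem {E = E} {Y = Y} xs xs-in)) ⟩
    ((n ≤ᵇ l) ∧ rel E n s xs) ∧ allMem σ (mem Y) xs      ≡⟨ r n s xs ⟩
    (n ≤ᵇ l) ∧ rel G n s xs                              ≡⟨ cong (_∧ rel G n s xs) (≤ᵇ-true {n} {l} n≤l) ⟩
    rel G n s xs                                         ∎
    where open ≡-Reasoning

  overlaid-cong : ∀ k Y → univ E ≐ univ E′ → (xs : Vec ℕ n) → overlaid k Y E xs ≡ overlaid k Y E′ xs
  overlaid-cong {n = n} k Y u xs =
    cong ((n ≡ᵇ suc k) ∧_) (allMem-cong (λ j → cong (_∧ mem Y j) (u j)) xs)

  overlay-cong : ∀ k Y → E ≈ E′ → G ≈ G′ → overlay k Y E G ≈ overlay k Y E′ G′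
  overlay-cong {E} {E′} k Y (mk≈ u r) (mk≈ _ r′) = mk≈ u λ n s xs →
    if-cong₃ (overlaid-cong {E = E} {E′} k Y u xs) (r′ n s xs) (r n s xs)
    where
      if-cong₃ : ∀ {b b′ x x′ y y′ : Bool} → b ≡ b′ → x ≡ x′ → y ≡ y′ →
                 (if b then x else y) ≡ (if b′ then x′ else y′)
      if-cong₃ refl refl refl = refl

  overlay-emptyAbove : ∀ k Y → EmptyAbove (suc k) E → EmptyAbove (suc k) G →
                       EmptyAbove (suc k) (overlay k Y E G)
  overlay-emptyAbove {E} k Y emptyE emptyG n s xs k<n with overlaid k Y E xs
  ... | true = emptyG n s xs k<n
  ... | false = emptyE n s xs k<n

  frame-overlay : ∀ k Y E G → overlay k Y E G ⁽ k ⁾ ≈ E ⁽ k ⁾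
  frame-overlay k Y E G = mk≈ (λ _ → refl) below
    where
      below : ∀ n s xs → (n ≤ᵇ k) ∧ rel (overlay k Y E G) n s xs ≡ (n ≤ᵇ k) ∧ rel E n s xs
      below n s xs with n ≤ᵇ k in n≤k
      ... | false = refl
      ... | true rewrite ≡ᵇ-false {n} {suc k} (<⇒≢ (s≤s (≤ᵇ-true⁻ n≤k))) = refl

  overlay-overlay : ∀ k Y E G H → overlay k Y (overlay k Y E G) H ≈ overlay k Y E H
  overlay-overlay k Y E G H = mk≈ (λ _ → refl) λ n s xs → same n s xs
    where
      same : ∀ n s xs → rel (overlay k Y (overlay k Y E G) H) n s xs ≡ rel (overlay k Y E H) n s xs
      same n s xs with overlaid k Y E xs
      ... | true = refl
      ... | false = refl

  overlay-self : ∀ k Y → AgreeAt (suc k) Y E G → overlay k Y E G ≈ E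
  overlay-self {E} {G} k Y agree = mk≈ (λ _ → refl) same
    where
      same : ∀ n s xs → rel (overlay k Y E G) n s xs ≡ rel E n s xs
      same n s xs with overlaid k Y E xs in ov
      ... | false = refl
      ... | true with ≡ᵇ-true⁻ {n} {suc k} (∧-conicalˡ (n ≡ᵇ suc k) _ ov)
      ...   | refl = sym (agree s xs (∧-conicalʳ (n ≡ᵇ n) _ ov))

  overlay-injective : ∀ k Y G → E ↾ Y ≈ E′ ↾ Y → overlay k Y E G ≈ overlay k Y E′ G → E ≈ E′
  overlay-injective {E} {E′} k Y G (mk≈ _ r↾) (mk≈ u r) = mk≈ u same
    where
      same : ∀ n s xs → rel E n s xs ≡ rel E′ n s xs
      same n s xs with overlaid k Y E xs in ov | r n s xs | r↾ n s xs
      ... | false | eq | _ rewrite sym (overlaid-cong {E = E} {E′} k Y u xs) | ov = eq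
      ... | true | _ | eq rewrite inside⇒allMem {E = E} {Y = Y} xs (∧-conicalʳ (n ≡ᵇ suc k) _ ov) =
        trans (sym (∧-identityʳ _)) (trans eq (∧-identityʳ _))

  agree-off-overlay : ∀ k Y → EmptyAbove (suc k) E → EmptyAbove (suc k) G → AgreeUpTo k Y E G →
                      (s : Fin (nsym σ n)) (xs : Vec ℕ n) →
                      inside E Y xs ≡ true → overlaid k Y E xs ≡ false → rel E n s xs ≡ rel G n s xs
  agree-off-overlay {n = n} k Y emptyE emptyG agree s xs xs-in ov with <-cmp n (suc k)
  ... | tri< n<1+k _ _ = agree (s≤s⁻¹ n<1+k) s xs xs-in
  ... | tri≈ _ refl _ = ⊥-elim (true≢false (∧-intro (≡ᵇ-true {n} refl) xs-in) ov)
  ... | tri> _ _ 1+k<n = trans (emptyE n s xs 1+k<n) (sym (emptyG n s xs 1+k<n))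

  overlay-restrict : ∀ k Y → EmptyAbove (suc k) E → EmptyAbove (suc k) G → AgreeUpTo k Y E G →
                     univ G ≐ univ (E ↾ Y) → overlay k Y E G ↾ Y ≈ G
  overlay-restrict {E} {G} k Y emptyE emptyG agree uG = mk≈ (λ j → sym (uG j)) same
    where
      outside : ∀ {n} (xs : Vec ℕ n) i → mem (univ (E ↾ Y)) (lookup xs i) ≡ false →
                ∀ s → rel G n s xs ≡ false
      outside xs i out s = rel-outside G s xs i (trans (uG _) out)

      same : ∀ n s xs → rel (overlay k Y E G ↾ Y) n s xs ≡ rel G n s xs
      same n s xs with allMem σ (mem Y) xs in xs-Y
      ... | false with allMem-false xs xs-Y
      ...   | i , out = trans (∧-zeroʳ _)
                          (sym (outside xs i (trans (cong (mem (univ E) _ ∧_) out) (∧-zeroʳ _)) s))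
      same n s xs | true with overlaid k Y E xs in ov
      ... | true = ∧-identityʳ _
      ... | false with inside E Y xs in xs-in
      ...   | true = trans (∧-identityʳ _) (agree-off-overlay {E = E} {G} k Y emptyE emptyG agree s xs xs-in
                                                      (trans (cong ((n ≡ᵇ suc k) ∧_) xs-in) ov))
      ...   | false with allMem-false xs xs-in
      ...     | i , out = trans (∧-identityʳ _) (trans (rel-outside E s xs i out-E) (sym (outside xs i out s)))
        where
          out-E : mem (univ E) (lookup xs i) ≡ false
          out-E = trans (sym (∧-identityʳ _)) (trans (cong (_ ∧_) (sym (allMem-lookup xs xs-Y i))) out)

  boundedTuples? : ∀ b n {P : Vec ℕ n → Set} → (∀ xs → Dec (P xs)) →
                   Dec (∀ xs → AllV (_< b) xs → P xs)
  boundedTuples? b zero P? = map′ (λ p → λ { [] [] → p }) (λ h → h [] []) (P? [])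
  boundedTuples? b (suc n) P? =
    map′ (λ h → λ { (x ∷ xs) (x<b ∷ xs<b) → h x<b xs xs<b }) (λ h {x} x<b xs xs<b → h (x ∷ xs) (x<b ∷ xs<b))
         (allUpTo? (λ x → boundedTuples? b n (λ xs → P? (x ∷ xs))) b)

  related-bounded : ∀ {X} → univ E ≐ X → (s : Fin (nsym σ n)) (xs : Vec ℕ n) →
                    rel E n s xs ≡ true → AllV (_< bnd X) xs
  related-bounded {E = E} {X = X} uE s xs related =
    AllV.map (λ {x} x∈E → bounded X x (trans (sym (uE x)) x∈E)) (relIn E _ s xs related)

  agree-if-agree-bounded : ∀ {X} → univ E ≐ X → univ E′ ≐ X → (s : Fin (nsym σ n)) (xs : Vec ℕ n) →
                           (AllV (_< bnd X) xs → rel E n s xs ≡ rel E′ n s xs) → rel E n s xs ≡ rel E′ n s xs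
  agree-if-agree-bounded {E = E} {E′} {X = X} uE uE′ s xs h with rel E _ s xs in e
  ... | true = h (related-bounded {E = E} {X = X} uE s xs e)
  ... | false with rel E′ _ s xs in e′
  ...   | false = refl
  ...   | true = h (related-bounded {E = E′} {X = X} uE′ s xs e′)

  frame≈? : ∀ k {X} → univ E ≐ X → univ E′ ≐ X → Dec (E ⁽ k ⁾ ≈ E′ ⁽ k ⁾)
  frame≈? {E} {E′} k {X} uE uE′ =
    map′ sound complete
      (allUpTo? (λ n → all? λ s → boundedTuples? (bnd X) n λ xs → rel E n s xs ≟ᴮ rel E′ n s xs) (suc k))
    where
      AgreeBounded : Set
      AgreeBounded = ∀ {n} → n < suc k → ∀ s xs → AllV (_< bnd X) xs → rel E n s xs ≡ rel E′ n s xs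

      sound : AgreeBounded → E ⁽ k ⁾ ≈ E′ ⁽ k ⁾
      sound h = mk≈ (λ j → trans (uE j) (sym (uE′ j))) low
        where
          low : ∀ n s xs → (n ≤ᵇ k) ∧ rel E n s xs ≡ (n ≤ᵇ k) ∧ rel E′ n s xs
          low n s xs with n ≤ᵇ k in n≤k
          ... | false = refl
          ... | true = agree-if-agree-bounded {E = E} {E′} {X = X} uE uE′ s xs (h (s≤s (≤ᵇ-true⁻ n≤k)) s xs)

      complete : E ⁽ k ⁾ ≈ E′ ⁽ k ⁾ → AgreeBounded
      complete eq {n} n<1+k s xs _ =
        subst (λ b → b ∧ rel E n s xs ≡ b ∧ rel E′ n s xs) (≤ᵇ-true {n} {k} (s≤s⁻¹ n<1+k)) (rel≡ eq n s xs)

  open import Data.List.Membership.Setoid ≈-setoid using () renaming (_∈_ to _∈≈_)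
  open import Data.List.Relation.Unary.Unique.Setoid ≈-setoid using () renaming (Unique to Unique≈)

  private
    variable
      P Q : Str σ → Set
      L L′ : List (Str σ)

  Enumerates-unique : Enumerates σ P L → Unique≈ L
  Enumerates-unique (_ , distinct , _) = AllPairs.map (λ A≇B A≈B → A≇B (≈⇒≅ A≈B)) distinct

  Enumerates-complete : Enumerates σ P L → ∀ A → P A → A ∈≈ L
  Enumerates-complete (_ , _ , complete) A PA = Any.map ≅⇒≈ (complete A PA)

  Enumerates-resp : (∀ F → P F → Q F) → (∀ F → Q F → P F) → Enumerates σ P L → Enumerates σ Q L
  Enumerates-resp P⇒Q Q⇒P (members , distinct , complete) =
    AllL.map (P⇒Q _) members , distinct , λ S QS → complete S (Q⇒P S QS)

  Enumerates-length : (∀ F → P F → Q F) → (∀ F → Q F → P F) →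
                      Enumerates σ P L → Enumerates σ Q L′ → length L ≡ length L′
  Enumerates-length P⇒Q Q⇒P enumL@(membersL , _) enumL′@(membersL′ , _) =
    unique-⊆-⊇⇒length≡ ≈-setoid (Enumerates-unique enumL) (Enumerates-unique enumL′)
      (all⇒⊆ ≈-setoid membersL λ F PF → Enumerates-complete enumL′ F (P⇒Q F PF))
      (all⇒⊆ ≈-setoid membersL′ λ F QF → Enumerates-complete enumL F (Q⇒P F QF))

  AgreeOn : Str σ → Str σ → Vec ℕ m → Set
  AgreeOn {m} C D xs = ∀ n s (ys : Vec (Fin m) n) →
    rel C n s (vmap (lookup xs) ys) ≡ rel D n s (vmap (lookup xs) ys)

  evalQF-agree : (xs : Vec ℕ m) → AgreeOn C D xs → ∀ φ → evalQF σ C xs φ ≡ evalQF σ D xs φ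
  evalQF-agree xs h ⊤f = refl
  evalQF-agree xs h ⊥f = refl
  evalQF-agree xs h (eqf a b) = refl
  evalQF-agree xs h (relf n s ys) = h n s ys
  evalQF-agree xs h (negf φ) = cong not (evalQF-agree xs h φ)
  evalQF-agree xs h (andf φ ψ) = cong₂ _∧_ (evalQF-agree xs h φ) (evalQF-agree xs h ψ)
  evalQF-agree xs h (orf φ ψ) = cong₂ _∨_ (evalQF-agree xs h φ) (evalQF-agree xs h ψ)

  Repeats : Vec (Fin m) n → Set
  Repeats {n = n} ys = ∃ λ (i : Fin n) → ∃ λ j → i ≢ j × lookup ys i ≡ lookup ys j

  long⇒repeats : m < n → (ys : Vec (Fin m) n) → Repeats ys
  long⇒repeats m<n ys with pigeonhole m<n (lookup ys)
  ... | i , j , i<j , eq = i , j , (λ e → <⇒≢ i<j (cong Fin.toℕ e)) , eq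

  missing⇒repeats : m ≤ n → (ys : Vec (Fin m) n) (v : Fin m) → (∀ q → lookup ys q ≢ v) → Repeats ys
  missing⇒repeats {suc m} m≤n ys v miss
    with pigeonhole m≤n (λ q → Fin.punchOut (λ e → miss q (sym e)))
  ... | i , j , i<j , eq =
    i , j , (λ e → <⇒≢ i<j (cong Fin.toℕ e)) ,
    punchOut-injective (λ e → miss i (sym e)) (λ e → miss j (sym e)) eq

  -- Local classes

  module _ (Φ : Local σ → Set) where

    -- Local sentences only look at the atoms over one related tuple, so membership in K can be
    -- certified tuple by tuple, each time by a member of K sharing those atoms.
    InK-local : (C : Str σ) →
                (∀ m s xs → rel C m s xs ≡ true →
                  ∃ λ D → InK σ Φ D × rel D m s xs ≡ true × AgreeOn C D xs) →
                InK σ Φ C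
    InK-local C h φ φ∈Φ xs related with h (suc (ar φ)) (relSymbol φ) xs related
    ... | D , D∈K , relD , agree = trans (evalQF-agree xs agree (body φ)) (D∈K φ φ∈Φ xs relD)

    InK-resp : A ≈ B → InK σ Φ A → InK σ Φ B
    InK-resp {A} {B} (mk≈ _ r) A∈K φ φ∈Φ xs related =
      trans (evalQF-agree xs (λ n s ys → sym (r n s _)) (body φ)) (A∈K φ φ∈Φ xs (trans (r _ _ xs) related))

    restrict-InK : ∀ Y → InK σ Φ E → InK σ Φ (E ↾ Y)
    restrict-InK {E} Y E∈K = InK-local (E ↾ Y) λ m s xs related →
      E , E∈K , ∧-conicalˡ (rel E m s xs) _ related ,
      λ n s′ ys → trans (cong (rel E n s′ (vmap (lookup xs) ys) ∧_)
                          (allMem-map-lookup xs ys (∧-conicalʳ (rel E m s xs) _ related)))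
                        (∧-identityʳ _)

    module _ (gi : ContainsGI σ Φ) where

      related-injective : InK σ Φ E → (s : Fin (nsym σ n)) (zs : Vec ℕ n) → rel E n s zs ≡ true →
                          ∀ i j → lookup zs i ≡ lookup zs j → i ≡ j
      related-injective E∈K s zs related i j eq with i ≟ᶠ j
      ... | yes i≡j = i≡j
      ... | no i≢j = ⊥-elim (irreflexive E∈K s zs related i j i≢j eq)
        where
          irreflexive : InK σ Φ E → ∀ {n} (s : Fin (nsym σ n)) (zs : Vec ℕ n) → rel E n s zs ≡ true →
                        ∀ i j → i ≢ j → lookup zs i ≡ lookup zs j → ⊥
          irreflexive _ {suc zero} _ _ _ fzero fzero i≢j _ = i≢j refl
          irreflexive E∈K {suc (suc n)} s zs related i j i≢j eq =
            true≢false (E∈K (GI σ n s i j) (gi n s i j i≢j) zs related)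
                       (cong not (≡ᵇ-true {lookup zs i} {lookup zs j} eq))

      repeats-false : InK σ Φ E → (s : Fin (nsym σ n)) (xs : Vec ℕ m) (ys : Vec (Fin m) n) →
                      Repeats ys → rel E n s (vmap (lookup xs) ys) ≡ false
      repeats-false E∈K s xs ys (i , j , i≢j , eq) = ¬-not λ related →
        i≢j (related-injective E∈K s _ related i j
              (trans (lookup-map i (lookup xs) ys)
                (trans (cong (lookup xs) eq) (sym (lookup-map j (lookup xs) ys)))))

      frame-InK : ∀ l → InK σ Φ E → InK σ Φ (E ⁽ l ⁾)
      frame-InK {E} l E∈K = InK-local (E ⁽ l ⁾) λ m s xs related →
        E , E∈K , ∧-conicalʳ (m ≤ᵇ l) _ related , agree (≤ᵇ-true⁻ (∧-conicalˡ (m ≤ᵇ l) _ related)) xs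
        where
          agree : m ≤ l → (xs : Vec ℕ m) → AgreeOn (E ⁽ l ⁾) E xs
          agree m≤l xs n s ys with n ≤ᵇ l in n≤l
          ... | true = refl
          ... | false = sym (repeats-false E∈K s xs ys
                          (long⇒repeats (≤-<-trans m≤l (≰⇒> λ p → true≢false (≤ᵇ-true p) n≤l)) ys))

      overlay-InK : ∀ k Y → InK σ Φ E → InK σ Φ G → EmptyAbove (suc k) E → EmptyAbove (suc k) G →
                    AgreeUpTo k Y E G → InK σ Φ (overlay k Y E G)
      overlay-InK {E} {G} k Y E∈K G∈K emptyE emptyG agree = InK-local (overlay k Y E G) witness
        where
          O = overlay k Y E G

          witness : ∀ m s xs → rel O m s xs ≡ true → ∃ λ D → InK σ Φ D × rel D m s xs ≡ true × AgreeOn O D xs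
          witness m s xs related with overlaid k Y E xs in ov
          ... | true = G , G∈K , related , agreeG
            where
              agreeG : AgreeOn O G xs
              agreeG n s′ ys with overlaid k Y E (vmap (lookup xs) ys) in ov′
              ... | true = refl
              ... | false = agree-off-overlay {E = E} {G} k Y emptyE emptyG agree s′ _
                              (allMem-map-lookup xs ys (∧-conicalʳ (m ≡ᵇ suc k) _ ov)) ov′
          ... | false = E , E∈K , related , agreeE
            where
              -- A (k+1)-tuple inside E ∩ Y built from the entries of xs must repeat an entry:
              -- either xs is too short, or xs has an entry outside E ∩ Y which it misses.
              sub-repeats : (ys : Vec (Fin m) (suc k)) → inside E Y (vmap (lookup xs) ys) ≡ true → Repeats ys
              sub-repeats ys sub-in with <-cmp m (suc k)
              ... | tri< m<1+k _ _ = long⇒repeats m<1+k ys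
              ... | tri> _ _ 1+k<m = ⊥-elim (true≢false related (emptyE m s xs 1+k<m))
              ... | tri≈ _ refl _ with allMem-false xs (trans (sym (cong (_∧ inside E Y xs) (≡ᵇ-true {m} refl))) ov)
              ...   | v , out with any? (λ q → lookup ys q ≟ᶠ v)
              ...     | yes (q , hit) = ⊥-elim (true≢false (allMem-lookup (vmap (lookup xs) ys) sub-in q)
                          (trans (cong (mem (univ (E ↾ Y)))
                                       (trans (lookup-map q (lookup xs) ys) (cong (lookup xs) hit))) out))
              ...     | no miss = missing⇒repeats ≤-refl ys v (λ q hit → miss (q , hit))

              agreeE : AgreeOn O E xs
              agreeE n s′ ys with overlaid k Y E (vmap (lookup xs) ys) in ov′
              ... | false = refl
              ... | true with ≡ᵇ-true⁻ {n} {suc k} (∧-conicalˡ (n ≡ᵇ suc k) _ ov′)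
              ...   | refl = trans (repeats-false G∈K s′ xs ys (sub-repeats ys sub-in))
                                   (sym (repeats-false E∈K s′ xs ys (sub-repeats ys sub-in)))
                where
                  sub-in = ∧-conicalʳ (n ≡ᵇ n) _ ov′

      -- An intrinsic description of the members F of NSet S k (the set counted by N(S,k)).
      record Extends (k : ℕ) (S F : Str σ) : Set where
        field
          member     : InK σ Φ F
          emptyAbove : EmptyAbove (suc k) F
          lower≈     : F ⁽ k ⁾ ≈ S ⁽ k ⁾

      NSet⇒Extends : ∀ {S k F} → NSet σ Φ S k F → Extends k S F
      NSet⇒Extends {S} {k} {F} (T , T∈K , _ , T≅S , T≅F) = record
        { member     = InK-resp T≈F (frame-InK (suc k) T∈K)
        ; emptyAbove = emptyAbove-resp T≈F (frame-emptyAbove (suc k) T)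
        ; lower≈     = ≈-trans (frame-cong k (≈-sym T≈F)) (≈-trans (frame-frame-suc T) (≅⇒≈ {T ⁽ k ⁾} T≅S)) }
        where
          T≈F = ≅⇒≈ {T ⁽ suc k ⁾} {F} T≅F

      Extends⇒NSet : ∀ {S k F} → Extends k S F → NSet σ Φ S k F
      Extends⇒NSet {S} {k} {F} ext =
        F , member , univ≐ lower≈ , ≈⇒≅ lower≈ , ≈⇒≅ (emptyAbove⇒frame≈ {suc k} {F} emptyAbove)
        where open Extends ext

      NSet-self : InK σ Φ S → ∀ k → NSet σ Φ S k (S ⁽ suc k ⁾)
      NSet-self {S} S∈K k = S , S∈K , (λ _ → refl) , ≈⇒≅ {S ⁽ k ⁾} ≈-refl , ≈⇒≅ {S ⁽ suc k ⁾} ≈-refl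

      NSet-resp : ∀ {S S′ k} → S ⁽ k ⁾ ≈ S′ ⁽ k ⁾ → ∀ F → NSet σ Φ S k F → NSet σ Φ S′ k F
      NSet-resp {S} {S′} {k} S≈S′ F (T , T∈K , uT , T≅S , T≅F) =
        T , T∈K , (λ j → trans (uT j) (univ≐ S≈S′ j)) , ≈⇒≅ (≈-trans (≅⇒≈ {T ⁽ k ⁾} T≅S) S≈S′) , T≅F

      HasN-length : ∀ {S S′ k n n′} → S ⁽ k ⁾ ≈ S′ ⁽ k ⁾ → HasN σ Φ S k n → HasN σ Φ S′ k n′ → n ≡ n′
      HasN-length {S} {S′} {k} S≈S′ (L , enum , refl) (L′ , enum′ , refl) =
        Enumerates-length {P = NSet σ Φ S k} {NSet σ Φ S′ k}
          (NSet-resp {S} {S′} {k} S≈S′) (NSet-resp {S′} {S} {k} (≈-sym S≈S′)) enum enum′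

      HasN-nonzero : InK σ Φ S → ∀ {k n} → HasN σ Φ S k n → ∃ λ m → n ≡ suc m
      HasN-nonzero {S} S∈K {k} (L , enum , refl) with Enumerates-complete enum (S ⁽ suc k ⁾) (NSet-self S∈K k)
      ... | here _ = _ , refl
      ... | there _ = _ , refl

      Mu-resp : ∀ {S S′ j r} → Mu σ Φ S j r → (∀ {i} → i < j → S ⁽ i ⁾ ≈ S′ ⁽ i ⁾) → Mu σ Φ S′ j r
      Mu-resp mu0 _ = mu0
      Mu-resp {S} {S′} (muS {k = i} μ (L , enum , len) eq) frames≈ =
        muS (Mu-resp μ (frames≈ ∘ m≤n⇒m≤1+n))
            (L , Enumerates-resp (NSet-resp {S} {S′} {i} S≈S′) (NSet-resp {S′} {S} {i} (≈-sym S≈S′)) enum , len) eq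
        where
          S≈S′ : S ⁽ i ⁾ ≈ S′ ⁽ i ⁾
          S≈S′ = frames≈ ≤-refl

      Mu-functional : ∀ {S S′ j r r′} → InK σ Φ S → Mu σ Φ S j r → Mu σ Φ S′ j r′ →
                      (∀ {i} → i < j → S ⁽ i ⁾ ≈ S′ ⁽ i ⁾) → r ≡ r′
      Mu-functional _ mu0 mu0 _ = refl
      Mu-functional {S} {S′} S∈K (muS {k = i} {q} {r} μ N eq) (muS {q = q′} {r′} {n′} μ′ N′ eq′) frames≈
        with HasN-nonzero S∈K N
      ... | m , refl = *-cancelʳ-fromℕ-suc m (begin
        r ℚ.* fromℕ (suc m)   ≡⟨ eq ⟩
        q                     ≡⟨ Mu-functional S∈K μ μ′ (frames≈ ∘ m≤n⇒m≤1+n) ⟩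
        q′                    ≡⟨ sym eq′ ⟩
        r′ ℚ.* fromℕ n′       ≡⟨ cong (λ n → r′ ℚ.* fromℕ n) (sym (HasN-length {S} {S′} {i} (frames≈ ≤-refl) N N′)) ⟩
        r′ ℚ.* fromℕ (suc m)  ∎)
        where open ≡-Reasoning

      record MuStep (S : Str σ) (k : ℕ) (r : ℚ) : Set where
        field
          r₀     : ℚ
          count  : ℕ
          mu₀    : Mu σ Φ S k r₀
          hasN   : HasN σ Φ S k count
          r·n≡r₀ : r ℚ.* fromℕ count ≡ r₀

      Mu-suc⁻ : ∀ {S k r} → Mu σ Φ S (suc k) r → MuStep S k r
      Mu-suc⁻ (muS μ N eq) = record { mu₀ = μ ; hasN = N ; r·n≡r₀ = eq }

      -- The sets K^{X,l}_{A,l}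

      module _ {A : Str σ} (A∈K : InK σ Φ A) {X : FinSub} (A⊆X : univ A ⊆ X) where

        private
          ∣A∣ = univ A

        -- An intrinsic description of the members S of K^{X,l}_{A,l}.
        record Over (l : ℕ) (S : Str σ) : Set where
          field
            member     : InK σ Φ S
            emptyAbove : EmptyAbove l S
            univ≐X     : univ S ≐ X
            restrict≈  : S ↾ ∣A∣ ≈ A ⁽ l ⁾

        KXA⇒Over : ∀ {l S} → KXA σ Φ X l A l S → Over l S
        KXA⇒Over {l} {S} (B , B∈K , uB , B↾≅ , B≅S) = record
          { member     = InK-resp B≈S (frame-InK l B∈K)
          ; emptyAbove = emptyAbove-resp B≈S (frame-emptyAbove l B)
          ; univ≐X     = λ j → trans (sym (univ≐ B≈S j)) (uB j)
          ; restrict≈  = ≈-trans (restrict-cong ∣A∣ (≈-sym B≈S)) (≅⇒≈ {B ⁽ l ⁾ ↾ ∣A∣} B↾≅) }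
          where
            B≈S = ≅⇒≈ {B ⁽ l ⁾} {S} B≅S

        Over⇒KXA : ∀ {l S} → Over l S → KXA σ Φ X l A l S
        Over⇒KXA {l} {S} over =
          S , member , univ≐X , ≈⇒≅ (≈-trans (restrict-cong ∣A∣ S⁽ˡ⁾≈S) restrict≈) , ≈⇒≅ S⁽ˡ⁾≈S
          where
            open Over over
            S⁽ˡ⁾≈S = emptyAbove⇒frame≈ {l} {S} emptyAbove

        univ-A≐restrict : univ E ≐ X → ∣A∣ ≐ univ (E ↾ ∣A∣)
        univ-A≐restrict {E} uE j with mem ∣A∣ j in j∈A
        ... | false = sym (∧-zeroʳ _)
        ... | true = sym (cong (_∧ true) (trans (uE j) (A⊆X j j∈A)))

        -- The k-admissible structures are those whose (k+1)-ary relations may be overlaid on |A|.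
        record Admissible (k : ℕ) (E : Str σ) : Set where
          field
            member     : InK σ Φ E
            emptyAbove : EmptyAbove (suc k) E
            univ≐X     : univ E ≐ X
            restrict≈  : E ⁽ k ⁾ ↾ ∣A∣ ≈ A ⁽ k ⁾

        Over-suc⇒Admissible : ∀ {k S} → Over (suc k) S → Admissible k S
        Over-suc⇒Admissible {k} {S} over = record
          { member = member ; emptyAbove = emptyAbove ; univ≐X = univ≐X
          ; restrict≈ = ≈-trans (≈-sym (frame-restrict k S ∣A∣))
                          (≈-trans (frame-cong k restrict≈) (frame-frame-suc A)) }
          where open Over over

        Over⇒Admissible : ∀ {k S} → Over k S → Admissible k S
        Over⇒Admissible {k} {S} over = record
          { member = member ; emptyAbove = λ n s xs k+1<n → emptyAbove n s xs (<⇒≤ k+1<n) ; univ≐X = univ≐X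
          ; restrict≈ = ≈-trans (restrict-cong ∣A∣ (emptyAbove⇒frame≈ {k} {S} emptyAbove)) restrict≈ }
          where open Over over

        Extends⇒Admissible : ∀ {k S F} → Admissible k S → Extends k S F → Admissible k F
        Extends⇒Admissible {k} {S} {F} adm ext = record
          { member = Extends.member ext ; emptyAbove = Extends.emptyAbove ext
          ; univ≐X = λ j → trans (univ≐ (Extends.lower≈ ext) j) (Admissible.univ≐X adm j)
          ; restrict≈ = ≈-trans (restrict-cong ∣A∣ (Extends.lower≈ ext)) (Admissible.restrict≈ adm) }

        module _ {k E G} (adm : Admissible k E) (ext : Extends k A G) where

          private
            module E = Admissible adm
            module G = Extends ext

            agree : AgreeUpTo k ∣A∣ E G
            agree n≤k = restrict-frame⇒agreeAt {E} {k} {∣A∣} {G} (≈-trans E.restrict≈ (≈-sym G.lower≈)) n≤k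

          overlay-member : InK σ Φ (overlay k ∣A∣ E G)
          overlay-member = overlay-InK k ∣A∣ E.member G.member E.emptyAbove G.emptyAbove agree

          overlay-restrict-A : overlay k ∣A∣ E G ↾ ∣A∣ ≈ G
          overlay-restrict-A = overlay-restrict k ∣A∣ E.emptyAbove G.emptyAbove agree
            (λ j → trans (univ≐ G.lower≈ j) (univ-A≐restrict {E} E.univ≐X j))

        A⁺-extends : ∀ k → Extends k A (A ⁽ suc k ⁾)
        A⁺-extends k = NSet⇒Extends (NSet-self A∈K k)

        overlay-A⁺-Over : ∀ {k E} → Admissible k E → Over (suc k) (overlay k ∣A∣ E (A ⁽ suc k ⁾))
        overlay-A⁺-Over {k} {E} adm = record
          { member     = overlay-member adm (A⁺-extends k)
          ; emptyAbove = overlay-emptyAbove {E} {A ⁽ suc k ⁾} k ∣A∣ (Admissible.emptyAbove adm)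
                                                                 (frame-emptyAbove (suc k) A)
          ; univ≐X     = Admissible.univ≐X adm
          ; restrict≈  = overlay-restrict-A adm (A⁺-extends k) }

        Over-frame : ∀ {k S} → Over (suc k) S → Over k (S ⁽ k ⁾)
        Over-frame {k} {S} over = record
          { member     = frame-InK k (Over.member over)
          ; emptyAbove = frame-emptyAbove k S
          ; univ≐X     = Over.univ≐X over
          ; restrict≈  = Admissible.restrict≈ (Over-suc⇒Admissible over) }

        Over-lift : ∀ {k S₀} → Over k S₀ → ∃ λ S → Over (suc k) S × S ⁽ k ⁾ ≈ S₀
        Over-lift {k} {S₀} over =
          overlay k ∣A∣ S₀ (A ⁽ suc k ⁾) , overlay-A⁺-Over (Over⇒Admissible over) ,
          ≈-trans (frame-overlay k ∣A∣ S₀ _) (emptyAbove⇒frame≈ {k} {S₀} (Over.emptyAbove over))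

        -- N(S₁,k) = N(A,k) · #Lifts: a (k+1)-frame F over S₁^(k) is determined by its part F ↾ |A|,
        -- which extends A^(k), and by the lift of S₁^(k) obtained by putting A's relations on |A| instead.
        module _ {k S₁} (over₁ : Over (suc k) S₁) where

          A⁺ = A ⁽ suc k ⁾

          Lifts : Str σ → Set
          Lifts E = Over (suc k) E × E ⁽ k ⁾ ≈ S₁ ⁽ k ⁾

          split : Str σ → Str σ × Str σ
          split F = F ↾ ∣A∣ , overlay k ∣A∣ F A⁺

          _≈²_ : Str σ × Str σ → Str σ × Str σ → Set
          (G , E) ≈² (G′ , E′) = G ≈ G′ × E ≈ E′

          private
            adm₁ = Over-suc⇒Admissible over₁

          split-NSet : ∀ {F} → NSet σ Φ S₁ k F → NSet σ Φ A k (F ↾ ∣A∣)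
          split-NSet {F} N = Extends⇒NSet {A} {k} {F ↾ ∣A∣} record
            { member     = restrict-InK ∣A∣ (Extends.member ext)
            ; emptyAbove = restrict-emptyAbove {suc k} {F} ∣A∣ (Extends.emptyAbove ext)
            ; lower≈     = ≈-trans (frame-restrict k F ∣A∣) (Admissible.restrict≈ (Extends⇒Admissible adm₁ ext)) }
            where ext = NSet⇒Extends {S₁} {k} {F} N

          split-Lifts : ∀ {F} → NSet σ Φ S₁ k F → Lifts (overlay k ∣A∣ F A⁺)
          split-Lifts {F} N =
            overlay-A⁺-Over (Extends⇒Admissible adm₁ ext) ,
            ≈-trans (frame-overlay k ∣A∣ F A⁺) (Extends.lower≈ ext)
            where ext = NSet⇒Extends {S₁} {k} {F} N

          merge-NSet : ∀ {G E} → NSet σ Φ A k G → Lifts E → NSet σ Φ S₁ k (overlay k ∣A∣ E G)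
          merge-NSet {G} {E} N (overE , E≈S₁) = Extends⇒NSet {S₁} {k} {overlay k ∣A∣ E G} record
            { member     = overlay-member (Over-suc⇒Admissible overE) G-ext
            ; emptyAbove = overlay-emptyAbove {E} {G} k ∣A∣ (Over.emptyAbove overE) (Extends.emptyAbove G-ext)
            ; lower≈     = ≈-trans (frame-overlay k ∣A∣ E G) E≈S₁ }
            where G-ext = NSet⇒Extends {A} {k} {G} N

          split-merge : ∀ {G E} → NSet σ Φ A k G → Lifts E → split (overlay k ∣A∣ E G) ≈² (G , E)
          split-merge {G} {E} N (overE , _) =
            overlay-restrict-A (Over-suc⇒Admissible overE) (NSet⇒Extends {A} {k} {G} N) ,
            ≈-trans (overlay-overlay k ∣A∣ E G A⁺) (overlay-self k ∣A∣ E-agrees-A⁺)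
            where
              E-agrees-A⁺ : AgreeAt (suc k) ∣A∣ E A⁺
              E-agrees-A⁺ = restrict-frame⇒agreeAt {E} {suc k} {∣A∣} {A⁺}
                (≈-trans (restrict-cong ∣A∣ (emptyAbove⇒frame≈ {suc k} {E} (Over.emptyAbove overE)))
                  (≈-trans (Over.restrict≈ overE) (≈-sym (frame-frame ≤-refl A)))) ≤-refl

          split-injective : ∀ {F F′} → split F ≈² split F′ → F ≈ F′
          split-injective (F↾≈ , overlay≈) = overlay-injective k ∣A∣ A⁺ F↾≈ overlay≈

          split-cong : ∀ {F F′} → F ≈ F′ → split F ≈² split F′
          split-cong F≈F′ = restrict-cong ∣A∣ F≈F′ , overlay-cong k ∣A∣ F≈F′ ≈-refl

          NSet-count : ∀ {n nA Lc} → HasN σ Φ S₁ k n → HasN σ Φ A k nA → Enumerates σ Lifts Lc →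
                       n ≡ nA * length Lc
          NSet-count {Lc = Lc} (La , enum₁ , refl) (Lb , enumA , refl) enumC = begin
            length La                          ≡⟨ sym (length-map split La) ⟩
            length (List.map split La)         ≡⟨ unique-⊆-⊇⇒length≡ Pair splits-unique pairs-unique
                                                    (all⇒⊆ Pair splits∈pairs (λ _ p∈ → p∈))
                                                    (all⇒⊆ Pair pairs∈splits (λ _ p∈ → p∈)) ⟩
            length (cartesianProduct Lb Lc)    ≡⟨ length-cartesianProduct Lb Lc ⟩
            length Lb * length Lc              ∎
            where
              open ≡-Reasoning
              Pair = ≈-setoid ×ₛ ≈-setoid
              open import Data.List.Membership.Setoid Pair using () renaming (_∈_ to _∈²_)

              splits-unique = UniqueP.map⁺ ≈-setoid Pair split-injective (Enumerates-unique enum₁)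
              pairs-unique = UniqueP.cartesianProduct⁺ ≈-setoid ≈-setoid
                               (Enumerates-unique enumA) (Enumerates-unique enumC)

              splits∈pairs : AllL.All (_∈² cartesianProduct Lb Lc) (List.map split La)
              splits∈pairs = AllLP.map⁺ (AllL.map (λ {F} N →
                AnyP.cartesianProduct⁺ (Enumerates-complete enumA (F ↾ ∣A∣) (split-NSet {F} N))
                                       (Enumerates-complete enumC _ (split-Lifts N))) (proj₁ enum₁))

              pairs∈splits : AllL.All (_∈² List.map split La) (cartesianProduct Lb Lc)
              pairs∈splits = AllLP.cartesianProduct⁺ (≡-setoid _) (≡-setoid _) Lb Lc λ G∈ E∈ →
                merged∈splits (AllL.lookup (proj₁ enumA) G∈) (AllL.lookup (proj₁ enumC) E∈)
                where
                  merged∈splits : ∀ {G E} → NSet σ Φ A k G → Lifts E → (G , E) ∈² List.map split La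
                  merged∈splits {G} {E} N lift = ∈-resp-≈ Pair (split-merge N lift)
                    (∈-map⁺ ≈-setoid Pair split-cong (Enumerates-complete enum₁ _ (merge-NSet {G} {E} N lift)))

        record Item (k : ℕ) : Set where
          field
            str  : Str σ
            val  : ℚ
            over : Over (suc k) str
            mu   : Mu σ Φ str (suc k) val

        zip-items : ∀ {k} (L : List (Str σ)) qs → AllL.All (Over (suc k)) L →
                    Pointwise (λ S r → Mu σ Φ S (suc k) r) L qs →
                    Σ (List (Item k)) λ is → List.map Item.str is ≡ L × List.map Item.val is ≡ qs
        zip-items [] [] [] [] = [] , refl , refl
        zip-items (S ∷ L) (r ∷ qs) (o ∷ os) (μ ∷ μs) with zip-items L qs os μs
        ... | is , refl , refl = record { str = S ; val = r ; over = o ; mu = μ } ∷ is , refl , refl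

        ItemsByFrame : ℕ → DecSetoid 0ℓ 0ℓ
        ItemsByFrame k = record
          { Carrier = Item k
          ; _≈_ = λ x y → Item.str x ⁽ k ⁾ ≈ Item.str y ⁽ k ⁾
          ; isDecEquivalence = record
            { isEquivalence = record { refl = ≈-refl ; sym = ≈-sym ; trans = ≈-trans }
            ; _≟_ = λ x y → frame≈? {Item.str x} {Item.str y} k {X}
                                 (Over.univ≐X (Item.over x)) (Over.univ≐X (Item.over y)) } }

        module Step (k : ℕ) {q q₀ : ℚ} {nA : ℕ} (NA : HasN σ Φ A k nA) (q·nA≡q₀ : q ℚ.* fromℕ nA ≡ q₀)
                    (ih : ∀ L₀ → Enumerates σ (KXA σ Φ X k A k) L₀ →
                            ∀ qs₀ → Pointwise (λ S r → Mu σ Φ S k r) L₀ qs₀ → q₀ ≡ sumℚ qs₀)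
                    (is : List (Item k)) (enum : Enumerates σ (KXA σ Φ X (suc k) A (suc k)) (List.map Item.str is))
                    where

          open Item
          open DecSetoid (ItemsByFrame k) using (_≟_)

          key : Item k → Str σ
          key d = str d ⁽ k ⁾

          val₀ : Item k → ℚ
          val₀ d = MuStep.r₀ (Mu-suc⁻ (mu d))

          reps : List (Item k)
          reps = deduplicate _≟_ is

          class : Item k → List (Item k)
          class d = classOf (ItemsByFrame k) d is

          keys-enumerate : Enumerates σ (KXA σ Φ X k A k) (List.map key reps)
          keys-enumerate =
            AllLP.map⁺ (AllL.universal (λ d → Over⇒KXA (Over-frame (over d))) reps) ,
            AllPairsP.map⁺ (AllPairs.map (λ d≉d′ key≅ → d≉d′ (≅⇒≈ key≅)) (deduplicate-! (ItemsByFrame k) is)) ,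
            complete
            where
              complete : ∀ S₀ → KXA σ Φ X k A k S₀ → Any.Any (_≅_ σ S₀) (List.map key reps)
              complete S₀ S₀∈K₀ with Over-lift (KXA⇒Over {k} {S₀} S₀∈K₀)
              ... | S , overS , S≈S₀ =
                AnyP.map⁺ (Any.map ≈⇒≅ (AnyP.deduplicate⁺ _≟_ (λ y≈x S₀≈x → ≈-trans S₀≈x (≈-sym y≈x))
                  (Any.map (λ S≈x → ≈-trans (≈-sym S≈S₀) (frame-cong k S≈x))
                    (AnyP.map⁻ (Enumerates-complete enum S (Over⇒KXA overS))))))

          mu-keys : ∀ ds → Pointwise (λ S r → Mu σ Φ S k r) (List.map key ds) (List.map val₀ ds)
          mu-keys [] = []
          mu-keys (d ∷ ds) =
            Mu-resp (MuStep.mu₀ (Mu-suc⁻ (mu d))) (λ i<k → ≈-sym (frame-frame (<⇒≤ i<k) (str d))) ∷ mu-keys ds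

          class-lifts : ∀ d → Enumerates σ (Lifts (over d)) (List.map str (class d))
          class-lifts d =
            AllLP.map⁺ (AllL.map (λ {y} y≈d → over y , y≈d) (AllLP.all-filter (_≟ d) is)) ,
            AllPairsP.map⁺ (AllPairsP.filter⁺ (_≟ d) (AllPairsP.map⁻ (proj₁ (proj₂ enum)))) ,
            λ E E-lifts → AnyP.map⁺ (any-filter⁺ (_≟ d)
              (λ {y} E≅y → ≈-trans (frame-cong k (≈-sym (≅⇒≈ {E} {str y} E≅y))) (proj₂ E-lifts))
              (AnyP.map⁻ (proj₂ (proj₂ enum) E (Over⇒KXA (proj₁ E-lifts)))))

          count-class : ∀ d → MuStep.count (Mu-suc⁻ (mu d)) ≡ nA * length (class d)
          count-class d = trans (NSet-count (over d) (MuStep.hasN (Mu-suc⁻ (mu d))) NA (class-lifts d))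
                                (cong (nA *_) (length-map str (class d)))

          class-values : ∀ d → ∑ val (class d) ≡ fromℕ (length (class d)) ℚ.* val d
          class-values d = trans
            (∑-cong (AllL.map (λ {y} y≈d → Mu-functional (Over.member (over y)) (mu y) (mu d)
                                              (λ i<1+k → frame-below {str y} {k} {str d} y≈d (s≤s⁻¹ i<1+k)))
                              (AllLP.all-filter (_≟ d) is)))
            (∑-const (val d) (class d))

          val₀-by-class : ∀ d → val₀ d ≡ fromℕ nA ℚ.* ∑ val (class d)
          val₀-by-class d = begin
            val₀ d                                       ≡⟨ sym (MuStep.r·n≡r₀ (Mu-suc⁻ (mu d))) ⟩
            val d ℚ.* fromℕ (MuStep.count (Mu-suc⁻ (mu d)))  ≡⟨ cong (λ n → val d ℚ.* fromℕ n) (count-class d) ⟩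
            val d ℚ.* fromℕ (nA * ℓ)                     ≡⟨ cong (val d ℚ.*_) (fromℕ-homo-* nA ℓ) ⟩
            val d ℚ.* (fromℕ nA ℚ.* fromℕ ℓ)             ≡⟨ ℚP.*-comm (val d) _ ⟩
            fromℕ nA ℚ.* fromℕ ℓ ℚ.* val d               ≡⟨ ℚP.*-assoc (fromℕ nA) (fromℕ ℓ) (val d) ⟩
            fromℕ nA ℚ.* (fromℕ ℓ ℚ.* val d)             ≡⟨ cong (fromℕ nA ℚ.*_) (sym (class-values d)) ⟩
            fromℕ nA ℚ.* ∑ val (class d)                 ∎
            where
              open ≡-Reasoning
              ℓ = length (class d)

          q·nA≡∑·nA : q ℚ.* fromℕ nA ≡ ∑ val is ℚ.* fromℕ nA
          q·nA≡∑·nA = begin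
            q ℚ.* fromℕ nA                               ≡⟨ q·nA≡q₀ ⟩
            q₀                                           ≡⟨ ih _ keys-enumerate _ (mu-keys reps) ⟩
            ∑ val₀ reps                                  ≡⟨ ∑-cong (AllL.universal val₀-by-class reps) ⟩
            ∑ (λ d → fromℕ nA ℚ.* ∑ val (class d)) reps  ≡⟨ sym (∑-*ˡ (fromℕ nA) _ reps) ⟩
            fromℕ nA ℚ.* ∑ (λ d → ∑ val (class d)) reps  ≡⟨ cong (fromℕ nA ℚ.*_)
                                                                 (sym (∑-by-representatives (ItemsByFrame k) val is)) ⟩
            fromℕ nA ℚ.* ∑ val is                        ≡⟨ ℚP.*-comm (fromℕ nA) _ ⟩
            ∑ val is ℚ.* fromℕ nA                        ∎
            where open ≡-Reasoning

          step : q ≡ ∑ val is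
          step with HasN-nonzero A∈K NA
          ... | m , nA≡1+m =
            *-cancelʳ-fromℕ-suc m (subst (λ n → q ℚ.* fromℕ n ≡ ∑ val is ℚ.* fromℕ n) nA≡1+m q·nA≡∑·nA)

        -- The unique member of K^{X,0}_{A,0}.
        B₀ : Str σ
        B₀ = record { univ = X ; rel = rel₀ ; relIn = relIn₀ }
          where
            rel₀ : (n : ℕ) → Fin (nsym σ n) → Vec ℕ n → Bool
            rel₀ zero s [] = rel A 0 s []
            rel₀ (suc n) s xs = false

            relIn₀ : ∀ n s xs → rel₀ n s xs ≡ true → AllV (λ x → mem X x ≡ true) xs
            relIn₀ zero s [] _ = []

        B₀-over : Over 0 B₀
        B₀-over = record
          { member     = λ φ _ xs ()
          ; emptyAbove = λ { (suc n) s xs _ → refl }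
          ; univ≐X     = λ _ → refl
          ; restrict≈  = mk≈ (λ j → sym (univ-A≐restrict {B₀} (λ _ → refl) j)) same }
          where
            same : ∀ n s xs → rel (B₀ ↾ ∣A∣) n s xs ≡ rel (A ⁽ 0 ⁾) n s xs
            same zero s [] = ∧-identityʳ _
            same (suc n) s xs = refl

        Over-zero-unique : Over 0 S → S ≈ B₀
        Over-zero-unique {S} over = mk≈ univ≐X same
          where
            open Over over
            same : ∀ n s xs → rel S n s xs ≡ rel B₀ n s xs
            same zero s [] = trans (sym (∧-identityʳ _)) (rel≡ restrict≈ zero s [])
            same (suc n) s xs = emptyAbove (suc n) s xs (s≤s z≤n)

        enumeration-zero-singleton : ∀ {L} → Enumerates σ (KXA σ Φ X 0 A 0) L → length L ≡ 1
        enumeration-zero-singleton enum = ≤-antisym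
          (unique-⊆⇒length≤ ≈-setoid {ys = B₀ ∷ []} (Enumerates-unique enum)
            (all⇒⊆ ≈-setoid (proj₁ enum) λ S S∈K₀ → here (Over-zero-unique (KXA⇒Over {0} {S} S∈K₀))))
          (∈-length ≈-setoid (Enumerates-complete enum B₀ (Over⇒KXA B₀-over)))

        KXA-sum-zero : ∀ {q} → Mu σ Φ A 0 q → ∀ L → Enumerates σ (KXA σ Φ X 0 A 0) L →
                       ∀ qs → Pointwise (λ S r → Mu σ Φ S 0 r) L qs → q ≡ sumℚ qs
        KXA-sum-zero mu0 (_ ∷ []) _ (_ ∷ []) (mu0 ∷ []) = refl
        KXA-sum-zero mu0 [] enum _ _ with enumeration-zero-singleton enum
        ... | ()
        KXA-sum-zero mu0 (_ ∷ _ ∷ _) enum _ _ with enumeration-zero-singleton enum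
        ... | ()

        KXA-sum : ∀ k {q} → Mu σ Φ A k q → ∀ L → Enumerates σ (KXA σ Φ X k A k) L →
                  ∀ qs → Pointwise (λ S r → Mu σ Φ S k r) L qs → q ≡ sumℚ qs
        KXA-sum zero μ = KXA-sum-zero μ
        KXA-sum (suc k) (muS μ NA q·nA≡q₀) L enum qs μs
          with zip-items L qs (AllL.map (KXA⇒Over {suc k} {_}) (proj₁ enum)) μs
        ... | is , refl , refl = Step.step k NA q·nA≡q₀ (KXA-sum k μ) is enum

lemma5p6 : (σ : Sig) (Φ : Local σ → Set) → ContainsGI σ Φ →
    (i : ℕ∞) (A : Str σ) → InK σ Φ A → univ A ⊆below i →
    (k : ℕ) → k ≤ card (univ A) →
    (X : FinSub) → X ⊆below i → univ A ⊆ X →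
    (q : ℚ) → Mu σ Φ A k q →
    (L : List (Str σ)) → Enumerates σ (KXA σ Φ X k A k) L →
    (qs : List ℚ) → Pointwise (λ S r → Mu σ Φ S k r) L qs →
    q ≡ sumℚ qs
lemma5p6 σ Φ gi _ A A∈K _ k _ X _ A⊆X q μ L enum qs μs = KXA-sum σ Φ gi {A} A∈K {X} A⊆X k μ L enum qs μs
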